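{- Let $K,P$ be positive integers with $2K\le P$, let $n\ge 2$, and let $\theta=(K,P)$. For each $r=2,\dots,n$ and each spanning tree $T$ on the vertex set $\{1,\dots,r\}$, $$\mathbb{P}\big[T\subset\mathbb{K}_r(n;\theta)\big]=\big(1-q(\theta)\big)^{r-1},$$ where $T\subset\mathbb{K}_r(n;\theta)$ means that every edge of $T$ is an edge of $\mathbb{K}_r(n;\theta)$.
   Context: The random key graph $\mathbb{K}(n;\theta)$ on vertex set $\{1,\dots,n\}$ is constructed as follows. Let $K_1(\theta),\dots,K_n(\theta)$ be i.i.d. random sets, each uniformly distributed over the $K$-element subsets of $\{1,\dots,P\}$. Distinct nodes $i,j$ are adjacent iff $K_i(\theta)\cap K_j(\theta)\ne\emptyset$. $\mathbb{K}_r(n;\theta)$ denotes the subgraph of $\mathbb{K}(n;\theta)$ induced on $\{1,\dots,r\}$. Here $q(\theta)=\binom{P-K}{K}\big/\binom{P}{K}$. -}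

module Defs where

open import Data.Bool using (Bool; true; false; _∧_; if_then_else_)
open import Data.Nat using (ℕ; zero; suc; _≤_; _∸_; _≟_)
open import Data.Nat.Combinatorics using (_C_)
open import Data.Fin as Fin using (Fin; inject≤; inject₁; fromℕ)
open import Data.Empty using (⊥)
import Data.Bool as Bool
open import Data.Fin.Subset using (Subset; ∣_∣)
open import Data.Vec using (Vec; []; _∷_; lookup)
open import Data.List using (List; []; _∷_; map; concatMap; filter; length; allFin)
open import Data.Bool.ListAction using (all; any)
open import Data.Product using (∃; _×_; _,_)
open import Data.Integer using (+_)
open import Data.Rational using (ℚ; _/_; 0ℚ; 1ℚ; _-_; _*_)
open import Relation.Nullary.Decidable using (⌊_⌋)
open import Relation.Binary.PropositionalEquality using (_≡_; _≢_)

-- Finite probability: uniform measure on a finite list of outcomes.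
-- prob Ω E = #{ω ∈ Ω | E ω} / |Ω|  (0 if Ω is empty, never used here).

count : {A : Set} → (A → Bool) → List A → ℕ
count E Ω = length (filter (λ ω → E ω Bool.≟ true) Ω)

ratio : ℕ → ℕ → ℚ
ratio a zero    = 0ℚ
ratio a (suc d) = (+ a) / suc d

prob : {A : Set} → List A → (A → Bool) → ℚ
prob Ω E = ratio (count E Ω) (length Ω)

infixr 8 _^ℚ_
_^ℚ_ : ℚ → ℕ → ℚ
x ^ℚ zero  = 1ℚ
x ^ℚ suc k = x * (x ^ℚ k)

-- Key pools and key rings.  Pool = {1,…,P} ≅ Fin P; a key ring is a
-- subset of the pool (Subset P = Vec Bool P).

allSubsets : (P : ℕ) → List (Subset P)
allSubsets zero    = [] ∷ []
allSubsets (suc P) = concatMap (λ s → (true ∷ s) ∷ (false ∷ s) ∷ []) (allSubsets P)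

kSubsets : (P K : ℕ) → List (Subset P)
kSubsets P K = filter (λ s → ∣ s ∣ ≟ K) (allSubsets P)

-- all n-tuples (K_1,…,K_n) of K-subsets: sample space of n i.i.d.
-- uniform key rings (product of uniform measures = uniform on tuples)
keyAssignments : (n P K : ℕ) → List (Vec (Subset P) n)
keyAssignments zero    P K = [] ∷ []
keyAssignments (suc n) P K =
  concatMap (λ s → map (s ∷_) (keyAssignments n P K)) (kSubsets P K)

meets : {P : ℕ} → Subset P → Subset P → Bool
meets {P} s t = any (λ i → lookup s i ∧ lookup t i) (allFin P)

q : (K P : ℕ) → ℚ
q K P = ratio ((P ∸ K) C K) (P C K)

record SimpleGraph (r : ℕ) : Set where
  field
    adj   : Fin r → Fin r → Bool
    irrefl : ∀ i → adj i i ≡ false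
    sym    : ∀ i j → adj i j ≡ adj j i
open SimpleGraph public

data Walk {r : ℕ} (G : SimpleGraph r) : Fin r → Fin r → Set where
  here : ∀ {u} → Walk G u u
  step : ∀ {u w v} → adj G u w ≡ true → Walk G w v → Walk G u v

Connected : {r : ℕ} → SimpleGraph r → Set
Connected G = ∀ u v → Walk G u v

-- A cycle: a list of vertices v₀ … v_k, k ≥ 2, pairwise distinct, with
-- v_i ~ v_{i+1} and v_k ~ v₀.
record Cycle {r : ℕ} (G : SimpleGraph r) : Set where
  field
    len      : ℕ
    vtx      : Fin (suc (suc (suc len))) → Fin r
    distinct : ∀ a b → vtx a ≡ vtx b → a ≡ b
    consec   : ∀ (a : Fin (suc (suc len))) →
               adj G (vtx (inject₁ a)) (vtx (Fin.suc a)) ≡ true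
    closing  : adj G (vtx (fromℕ (suc (suc len)))) (vtx Fin.zero) ≡ true

Acyclic : {r : ℕ} → SimpleGraph r → Set
Acyclic G = Cycle G → ⊥

record SpanningTree (r : ℕ) : Set where
  field
    graph     : SimpleGraph r
    connected : Connected graph
    acyclic   : Acyclic graph
open SpanningTree public

-- The event  T ⊂ 𝕂_r(n;θ):  every edge {i,j} of T (i,j ∈ {1,…,r} ⊆
-- {1,…,n}) satisfies K_i ∩ K_j ≠ ∅.

treeInside : {r n P : ℕ} → r ≤ n → SpanningTree r → Vec (Subset P) n → Bool
treeInside {r} r≤n T keys =
  all (λ i → all (λ j →
        if adj (graph T) i j
        then meets (lookup keys (inject≤ i r≤n)) (lookup keys (inject≤ j r≤n))
        else true) (allFin r)) (allFin r)

-- The probability space is uniform on the M^n tuples of K-subsets, where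
-- M = C(P,K); write N = C(P-K,K) for the number of K-subsets disjoint from a
-- fixed K-subset.  For a graph G on {1,…,r} let good(G) count the tuples in
-- which every edge of G joins two meeting key rings.  The argument counts:
--   * resampling: if ℓ is a leaf of G with neighbour p, then
--     M · good(G) = (M - N) · good(G - ℓ), because for fixed other rings
--     exactly M - N choices of K_ℓ meet K_p;
--   * every acyclic graph with an edge has a leaf, and deleting a leaf from a
--     tree on a vertex set A leaves a tree on A - {ℓ};
--   * hence, by induction on |A| = k + 1, M^k · good(T) = (M - N)^k · M^n,
--     and dividing by M^k · M^n gives the claimed power of 1 - N/M.
module Submission where

open import Defs
open import Data.Nat using (ℕ; _≤_; _*_; _∸_; zero; suc; _+_; _^_; z≤n; s≤s; _<_; _≟_)
open import Data.Rational using (1ℚ; _-_)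

import Data.Nat.Properties as NP
open import Data.Nat.Tactic.RingSolver using (solve-∀)
open import Data.Nat.Combinatorics using (_C_; nCk+nC[k+1]≡[n+1]C[k+1])
open import Data.Bool as B using (Bool; true; false; _∧_; _∨_; not; if_then_else_)
import Data.Bool.Properties as BP
open import Data.List using (List; []; _∷_; map; concatMap; filter; length; _++_; tabulate; allFin)
import Data.List.Properties as LP
open import Data.Bool.ListAction using (or; all)
open import Relation.Binary.PropositionalEquality as PE using (_≡_; refl; cong; cong₂; trans; subst; subst₂; module ≡-Reasoning)
open import Relation.Nullary using (yes; no; does; ¬_)
open import Relation.Nullary.Decidable using (_×-dec_; ¬?)
open import Relation.Unary using (Decidable)
open import Function using (_∘_; id)
import Data.Integer as ℤ
open ℤ using () renaming (+_ to pos)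
import Data.Integer.Properties as ℤP
open import Data.Integer.Solver using (module +-*-Solver)
import Data.Rational as Q
import Data.Rational.Properties as QP
import Data.Rational.Unnormalised as U
import Data.Rational.Unnormalised.Properties as UP
open import Data.Vec using (Vec; []; _∷_; lookup; _[_]≔_)
import Data.Vec.Properties as VP
open import Data.Fin as F using (Fin; inject≤; inject₁; fromℕ; toℕ)
import Data.Fin.Properties as FP
open import Data.Fin.Subset using (Subset; ∣_∣; ⊥; ⊤)
open import Data.Fin.Subset.Properties using (∣p∣≤n; ∣⊥∣≡0; ∣⊤∣≡n)
open import Data.Product using (Σ; ∃; _×_; _,_; proj₁)
open import Data.Sum using (_⊎_; inj₁; inj₂)
open import Data.Empty using () renaming (⊥ to Empty; ⊥-elim to ⊥-elim)

sumL : {A : Set} → (A → ℕ) → List A → ℕ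
sumL f [] = 0
sumL f (x ∷ xs) = f x + sumL f xs

ind : Bool → ℕ
ind true = 1
ind false = 0

count≡sumL : {A : Set} (E : A → Bool) (xs : List A) → count E xs ≡ sumL (ind ∘ E) xs
count≡sumL E [] = refl
count≡sumL E (x ∷ xs) with E x
... | true = cong suc (count≡sumL E xs)
... | false = count≡sumL E xs

length≡sumL : {A : Set} (xs : List A) → length xs ≡ sumL (λ _ → 1) xs
length≡sumL [] = refl
length≡sumL (x ∷ xs) = cong suc (length≡sumL xs)

sumL-++ : {A : Set} (f : A → ℕ) (xs ys : List A) → sumL f (xs ++ ys) ≡ sumL f xs + sumL f ys
sumL-++ f [] ys = refl
sumL-++ f (x ∷ xs) ys = trans (cong (f x +_) (sumL-++ f xs ys)) (PE.sym (NP.+-assoc (f x) _ _))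

sumL-concatMap : {A B : Set} (f : B → ℕ) (g : A → List B) (xs : List A) →
  sumL f (concatMap g xs) ≡ sumL (λ x → sumL f (g x)) xs
sumL-concatMap f g [] = refl
sumL-concatMap f g (x ∷ xs) =
  trans (sumL-++ f (g x) (concatMap g xs)) (cong (sumL f (g x) +_) (sumL-concatMap f g xs))

sumL-map : {A B : Set} (f : B → ℕ) (h : A → B) (xs : List A) → sumL f (map h xs) ≡ sumL (f ∘ h) xs
sumL-map f h [] = refl
sumL-map f h (x ∷ xs) = cong (f (h x) +_) (sumL-map f h xs)

sumL-cong : {A : Set} {f g : A → ℕ} (xs : List A) → (∀ x → f x ≡ g x) → sumL f xs ≡ sumL g xs
sumL-cong [] e = refl
sumL-cong (x ∷ xs) e = cong₂ _+_ (e x) (sumL-cong xs e)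

sumL-*ˡ : {A : Set} (c : ℕ) (f : A → ℕ) (xs : List A) → sumL (λ x → c * f x) xs ≡ c * sumL f xs
sumL-*ˡ c f [] = PE.sym (NP.*-zeroʳ c)
sumL-*ˡ c f (x ∷ xs) = trans (cong (c * f x +_) (sumL-*ˡ c f xs)) (PE.sym (NP.*-distribˡ-+ c (f x) _))

sumL-+ : {A : Set} (f g : A → ℕ) (xs : List A) → sumL (λ x → f x + g x) xs ≡ sumL f xs + sumL g xs
sumL-+ f g [] = refl
sumL-+ f g (x ∷ xs) = trans (cong (f x + g x +_) (sumL-+ f g xs)) (medial (f x) (g x) (sumL f xs) (sumL g xs))
  where
  medial : ∀ a b c d → a + b + (c + d) ≡ a + c + (b + d)
  medial = solve-∀

sumL-zero : {A : Set} (xs : List A) → sumL (λ _ → 0) xs ≡ 0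
sumL-zero [] = refl
sumL-zero (x ∷ xs) = sumL-zero xs

sumL-const : {A : Set} (c : ℕ) (xs : List A) → sumL (λ _ → c) xs ≡ length xs * c
sumL-const c [] = refl
sumL-const c (x ∷ xs) = cong (c +_) (sumL-const c xs)

sumL-swap : {A B : Set} (f : A → B → ℕ) (xs : List A) (ys : List B) →
  sumL (λ x → sumL (f x) ys) xs ≡ sumL (λ y → sumL (λ x → f x y) xs) ys
sumL-swap f [] ys = PE.sym (sumL-zero ys)
sumL-swap f (x ∷ xs) ys =
  trans (cong (sumL (f x) ys +_) (sumL-swap f xs ys)) (PE.sym (sumL-+ (f x) (λ y → sumL (λ x → f x y) xs) ys))

sumL-filter : {A : Set} {R : A → Set} (R? : Decidable R) (f : A → ℕ) (xs : List A) →
  sumL f (filter R? xs) ≡ sumL (λ x → if does (R? x) then f x else 0) xs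
sumL-filter R? f [] = refl
sumL-filter R? f (x ∷ xs) with does (R? x)
... | true = cong (f x +_) (sumL-filter R? f xs)
... | false = sumL-filter R? f xs

sumL-filter-cong : {A : Set} {R : A → Set} (R? : Decidable R) {f g : A → ℕ} (xs : List A) →
  (∀ x → R x → f x ≡ g x) → sumL f (filter R? xs) ≡ sumL g (filter R? xs)
sumL-filter-cong R? [] h = refl
sumL-filter-cong R? (x ∷ xs) h with R? x
... | yes r = cong₂ _+_ (h x r) (sumL-filter-cong R? xs h)
... | no _ = sumL-filter-cong R? xs h

ind-∧ : ∀ a b → ind (a ∧ b) ≡ ind a * ind b
ind-∧ true b = PE.sym (NP.+-identityʳ (ind b))
ind-∧ false b = refl

ind-complement : ∀ b → ind b + ind (not b) ≡ 1
ind-complement true = refl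
ind-complement false = refl

ratio-cross : ∀ a b c d → 0 < b → 0 < d → a * d ≡ c * b → ratio a b ≡ ratio c d
ratio-cross a (suc b) c (suc d) _ _ eq =
  QP.toℚᵘ-injective (UP.≃-trans (QP.toℚᵘ-fromℚᵘ (U.mkℚᵘ (pos a) b))
    (UP.≃-trans (U.*≡* cross) (UP.≃-sym (QP.toℚᵘ-fromℚᵘ (U.mkℚᵘ (pos c) d)))))
  where
  cross : pos a ℤ.* pos (suc d) ≡ pos c ℤ.* pos (suc b)
  cross = trans (PE.sym (ℤP.pos-* a (suc d))) (trans (cong pos eq) (ℤP.pos-* c (suc b)))

ratio-* : ∀ a b c d → ratio a b Q.* ratio c d ≡ ratio (a * c) (b * d)
ratio-* a zero c d = QP.*-zeroˡ (ratio c d)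
ratio-* a (suc b) c zero rewrite NP.*-zeroʳ b = QP.*-zeroʳ (ratio a (suc b))
ratio-* a (suc b) c (suc d) =
  QP.toℚᵘ-injective (UP.≃-trans (QP.toℚᵘ-homo-* (ratio a (suc b)) (ratio c (suc d)))
    (UP.≃-trans (UP.*-cong (QP.toℚᵘ-fromℚᵘ (U.mkℚᵘ (pos a) b)) (QP.toℚᵘ-fromℚᵘ (U.mkℚᵘ (pos c) d)))
    (UP.≃-trans (UP.≃-reflexive (cong (λ z → U.mkℚᵘ z (d + b * suc d)) (PE.sym (ℤP.pos-* a c))))
    (UP.≃-sym (QP.toℚᵘ-fromℚᵘ (U.mkℚᵘ (pos (a * c)) (d + b * suc d)))))))

ratio-^ : ∀ a b k → ratio a b ^ℚ k ≡ ratio (a ^ k) (b ^ k)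
ratio-^ a b zero = refl
ratio-^ a b (suc k) = trans (cong (ratio a b Q.*_) (ratio-^ a b k)) (ratio-* a b (a ^ k) (b ^ k))

ratio-+ : ∀ a b c → ratio a (suc b) Q.+ ratio c (suc b) ≡ ratio (a + c) (suc b)
ratio-+ a b c =
  QP.toℚᵘ-injective (UP.≃-trans (QP.toℚᵘ-homo-+ (ratio a (suc b)) (ratio c (suc b)))
    (UP.≃-trans (UP.+-cong (QP.toℚᵘ-fromℚᵘ (U.mkℚᵘ (pos a) b)) (QP.toℚᵘ-fromℚᵘ (U.mkℚᵘ (pos c) b)))
    (UP.≃-trans (U.*≡* cross) (UP.≃-sym (QP.toℚᵘ-fromℚᵘ (U.mkℚᵘ (pos (a + c)) b))))))
  where
  open +-*-Solver
  cross : (pos a ℤ.* pos (suc b) ℤ.+ pos c ℤ.* pos (suc b)) ℤ.* pos (suc b)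
        ≡ pos (a + c) ℤ.* (pos (suc b) ℤ.* pos (suc b))
  cross rewrite ℤP.pos-+ a c =
    solve 3 (λ x y z → (x :* z :+ y :* z) :* z := (x :+ y) :* (z :* z)) refl (pos a) (pos c) (pos (suc b))

1-ratio : ∀ N M → N ≤ suc M → 1ℚ Q.- ratio N (suc M) ≡ ratio (suc M ∸ N) (suc M)
1-ratio N M N≤ = begin
    1ℚ Q.- y         ≡⟨ cong (Q._- y) (PE.sym x+y≡1) ⟩
    (x Q.+ y) Q.- y  ≡⟨ QP.+-assoc x y (Q.- y) ⟩
    x Q.+ (y Q.- y)  ≡⟨ cong (x Q.+_) (QP.+-inverseʳ y) ⟩
    x Q.+ Q.0ℚ       ≡⟨ QP.+-identityʳ x ⟩
    x                ∎
  where
  open ≡-Reasoning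
  x = ratio (suc M ∸ N) (suc M)
  y = ratio N (suc M)
  x+y≡1 : x Q.+ y ≡ 1ℚ
  x+y≡1 = trans (ratio-+ (suc M ∸ N) M N)
    (trans (cong (λ z → ratio z (suc M)) (NP.m∸n+n≡m N≤))
    (ratio-cross (suc M) (suc M) 1 1 (s≤s z≤n) (s≤s z≤n)
      (trans (NP.*-identityʳ (suc M)) (PE.sym (NP.+-identityʳ (suc M))))))

ratio-from-count : ∀ M N c n k → 0 < M → N ≤ M → M ^ k * c ≡ (M ∸ N) ^ k * M ^ n →
  ratio c (M ^ n) ≡ (1ℚ - ratio N M) ^ℚ k
ratio-from-count (suc M) N c n k _ N≤M eq = begin
    ratio c (suc M ^ n)
  ≡⟨ ratio-cross c (suc M ^ n) ((suc M ∸ N) ^ k) (suc M ^ k) (NP.m^n>0 (suc M) n) (NP.m^n>0 (suc M) k)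
       (trans (NP.*-comm c (suc M ^ k)) eq) ⟩
    ratio ((suc M ∸ N) ^ k) (suc M ^ k)
  ≡⟨ PE.sym (ratio-^ (suc M ∸ N) (suc M) k) ⟩
    ratio (suc M ∸ N) (suc M) ^ℚ k
  ≡⟨ cong (_^ℚ k) (PE.sym (1-ratio N M N≤M)) ⟩
    (1ℚ - ratio N (suc M)) ^ℚ k
  ∎
  where open ≡-Reasoning

C-pos : ∀ n k → k ≤ n → 0 < n C k
C-pos n zero _ = s≤s z≤n
C-pos (suc n) (suc k) (s≤s k≤n) = NP.≤-trans (C-pos n k k≤n)
  (subst (n C k ≤_) (nCk+nC[k+1]≡[n+1]C[k+1] n k) (NP.m≤m+n (n C k) (n C suc k)))

C-mono : ∀ d n k → n C k ≤ (d + n) C k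
C-mono zero n k = NP.≤-refl
C-mono (suc d) n zero = NP.≤-refl
C-mono (suc d) n (suc k) = NP.≤-trans (C-mono d n (suc k))
  (subst ((d + n) C suc k ≤_) (nCk+nC[k+1]≡[n+1]C[k+1] (d + n) k) (NP.m≤n+m ((d + n) C suc k) ((d + n) C k)))

meets-∷ : ∀ {P} x y (s t : Subset P) → meets (x ∷ s) (y ∷ t) ≡ (x ∧ y) ∨ meets s t
meets-∷ x y s t = cong (λ z → (x ∧ y) ∨ or z)
  (trans (LP.map-tabulate F.suc (λ i → lookup (x ∷ s) i ∧ lookup (y ∷ t) i))
         (PE.sym (LP.map-tabulate id (λ i → lookup s i ∧ lookup t i))))

meets-sym : ∀ {P} (s t : Subset P) → meets s t ≡ meets t s
meets-sym [] [] = refl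
meets-sym (x ∷ s) (y ∷ t) =
  trans (meets-∷ x y s t) (trans (cong₂ _∨_ (BP.∧-comm x y) (meets-sym s t)) (PE.sym (meets-∷ y x t s)))

meets-⊥ : ∀ {P} (s : Subset P) → meets s ⊥ ≡ false
meets-⊥ [] = refl
meets-⊥ (x ∷ s) = trans (meets-∷ x false s ⊥) (trans (cong (_∨ meets s ⊥) (BP.∧-zeroʳ x)) (meets-⊥ s))

disjointOfSize : ∀ {P} → ℕ → Subset P → Subset P → ℕ
disjointOfSize k t s = if does (∣ s ∣ ≟ k) then ind (not (meets s t)) else 0

-- the k-subsets of {1,…,P} disjoint from t are the k-subsets of its complement
disjointCount : ∀ P (t : Subset P) k → sumL (disjointOfSize k t) (allSubsets P) ≡ (P ∸ ∣ t ∣) C k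
disjointCount zero [] zero = refl
disjointCount zero [] (suc k) = refl
disjointCount (suc P) (true ∷ t) k =
  trans (sumL-concatMap (disjointOfSize k (true ∷ t)) _ (allSubsets P))
  (trans (sumL-cong (allSubsets P) split) (disjointCount P t k))
  where
  split : ∀ s → disjointOfSize k (true ∷ t) (true ∷ s) + (disjointOfSize k (true ∷ t) (false ∷ s) + 0)
              ≡ disjointOfSize k t s
  split s rewrite meets-∷ true true s t | meets-∷ false true s t
    with does (suc ∣ s ∣ ≟ k)
  ... | true = NP.+-identityʳ _
  ... | false = NP.+-identityʳ _
disjointCount (suc P) (false ∷ t) zero =
  trans (sumL-concatMap (disjointOfSize 0 (false ∷ t)) _ (allSubsets P))
  (trans (sumL-cong (allSubsets P) split) (disjointCount P t 0))
  where
  split : ∀ s → disjointOfSize 0 (false ∷ t) (true ∷ s) + (disjointOfSize 0 (false ∷ t) (false ∷ s) + 0)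
              ≡ disjointOfSize 0 t s
  split s rewrite meets-∷ false false s t = NP.+-identityʳ _
disjointCount (suc P) (false ∷ t) (suc k) = begin
    sumL (disjointOfSize (suc k) (false ∷ t)) (allSubsets (suc P))
  ≡⟨ sumL-concatMap (disjointOfSize (suc k) (false ∷ t)) _ (allSubsets P) ⟩
    sumL (λ s → disjointOfSize (suc k) (false ∷ t) (true ∷ s) + (disjointOfSize (suc k) (false ∷ t) (false ∷ s) + 0))
         (allSubsets P)
  ≡⟨ sumL-cong (allSubsets P) split ⟩
    sumL (λ s → disjointOfSize k t s + disjointOfSize (suc k) t s) (allSubsets P)
  ≡⟨ sumL-+ (disjointOfSize k t) (disjointOfSize (suc k) t) (allSubsets P) ⟩
    sumL (disjointOfSize k t) (allSubsets P) + sumL (disjointOfSize (suc k) t) (allSubsets P)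
  ≡⟨ cong₂ _+_ (disjointCount P t k) (disjointCount P t (suc k)) ⟩
    (P ∸ ∣ t ∣) C k + (P ∸ ∣ t ∣) C suc k
  ≡⟨ nCk+nC[k+1]≡[n+1]C[k+1] (P ∸ ∣ t ∣) k ⟩
    suc (P ∸ ∣ t ∣) C suc k
  ≡⟨ cong (_C suc k) (PE.sym (NP.+-∸-assoc 1 (∣p∣≤n t))) ⟩
    (suc P ∸ ∣ t ∣) C suc k
  ∎
  where
  open ≡-Reasoning
  -- a ring avoiding t either contains the new key (k more to choose) or not
  split : ∀ s → disjointOfSize (suc k) (false ∷ t) (true ∷ s) + (disjointOfSize (suc k) (false ∷ t) (false ∷ s) + 0)
              ≡ disjointOfSize k t s + disjointOfSize (suc k) t s
  split s rewrite meets-∷ true false s t | meets-∷ false false s t =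
    cong (disjointOfSize k t s +_) (NP.+-identityʳ _)

-- Throughout, M = C(P,K) is the number of possible key rings and
-- N = C(P-K,K) the number of key rings disjoint from a given one.

module KeyRings (P K : ℕ) where

  rings : List (Subset P)
  rings = kSubsets P K

  assignments : (n : ℕ) → List (Vec (Subset P) n)
  assignments n = keyAssignments n P K

  M N : ℕ
  M = P C K
  N = (P ∸ K) C K

  length-rings : length rings ≡ M
  length-rings = begin
      length rings
    ≡⟨ length≡sumL rings ⟩
      sumL (λ _ → 1) rings
    ≡⟨ sumL-filter (λ s → ∣ s ∣ ≟ K) (λ _ → 1) (allSubsets P) ⟩
      sumL (λ s → if does (∣ s ∣ ≟ K) then 1 else 0) (allSubsets P)
    ≡⟨ sumL-cong (allSubsets P) (λ s → cong (λ b → if does (∣ s ∣ ≟ K) then ind (not b) else 0) (PE.sym (meets-⊥ s))) ⟩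
      sumL (disjointOfSize K ⊥) (allSubsets P)
    ≡⟨ disjointCount P ⊥ K ⟩
      (P ∸ ∣ ⊥ {P} ∣) C K
    ≡⟨ cong (λ z → (P ∸ z) C K) (∣⊥∣≡0 P) ⟩
      M
    ∎
    where open ≡-Reasoning

  disjointRings : ∀ t → ∣ t ∣ ≡ K → sumL (λ s → ind (not (meets s t))) rings ≡ N
  disjointRings t tK = trans (sumL-filter (λ s → ∣ s ∣ ≟ K) _ (allSubsets P))
    (trans (disjointCount P t K) (cong (λ z → (P ∸ z) C K) tK))

  meetingRings : ∀ t → ∣ t ∣ ≡ K → sumL (λ s → ind (meets s t)) rings ≡ M ∸ N
  meetingRings t tK = PE.sym (trans (cong (_∸ N) (PE.sym meeting+disjoint)) (NP.m+n∸n≡m _ N))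
    where
    meeting+disjoint : sumL (λ s → ind (meets s t)) rings + N ≡ M
    meeting+disjoint =
      trans (cong (sumL (λ s → ind (meets s t)) rings +_) (PE.sym (disjointRings t tK)))
      (trans (PE.sym (sumL-+ (λ s → ind (meets s t)) (λ s → ind (not (meets s t))) rings))
      (trans (sumL-cong rings (λ s → ind-complement (meets s t)))
      (trans (PE.sym (length≡sumL rings)) length-rings)))

  sum-assignments-∷ : ∀ n (G : Vec (Subset P) (suc n) → ℕ) →
    sumL G (assignments (suc n)) ≡ sumL (λ t → sumL (λ w → G (t ∷ w)) (assignments n)) rings
  sum-assignments-∷ n G = trans (sumL-concatMap G (λ s → map (s ∷_) (assignments n)) rings)
    (sumL-cong rings (λ t → sumL-map G (t ∷_) (assignments n)))

  length-assignments : ∀ n → length (assignments n) ≡ M ^ n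
  length-assignments zero = refl
  length-assignments (suc n) = begin
      length (assignments (suc n))
    ≡⟨ length≡sumL (assignments (suc n)) ⟩
      sumL (λ _ → 1) (assignments (suc n))
    ≡⟨ sum-assignments-∷ n (λ _ → 1) ⟩
      sumL (λ _ → sumL (λ _ → 1) (assignments n)) rings
    ≡⟨ sumL-cong rings (λ _ → trans (PE.sym (length≡sumL (assignments n))) (length-assignments n)) ⟩
      sumL (λ _ → M ^ n) rings
    ≡⟨ sumL-const (M ^ n) rings ⟩
      length rings * M ^ n
    ≡⟨ cong (_* M ^ n) length-rings ⟩
      M ^ suc n
    ∎
    where open ≡-Reasoning

  -- Resampling coordinate ℓ: replacing the ℓ-th ring by an independent
  -- uniform ring does not change the distribution of the assignment.
  resample : ∀ n (G : Vec (Subset P) n → ℕ) (ℓ : Fin n) →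
    length rings * sumL G (assignments n) ≡ sumL (λ ks → sumL (λ s → G (ks [ ℓ ]≔ s)) rings) (assignments n)
  resample (suc n) G F.zero = begin
      length rings * sumL G (assignments (suc n))
    ≡⟨ cong (length rings *_) (sum-assignments-∷ n G) ⟩
      length rings * sumL (λ t → sumL (λ w → G (t ∷ w)) (assignments n)) rings
    ≡⟨ cong (length rings *_) (sumL-swap (λ t w → G (t ∷ w)) rings (assignments n)) ⟩
      length rings * sumL (λ w → sumL (λ s → G (s ∷ w)) rings) (assignments n)
    ≡⟨ PE.sym (sumL-const _ rings) ⟩
      sumL (λ t → sumL (λ w → sumL (λ s → G (s ∷ w)) rings) (assignments n)) rings
    ≡⟨ PE.sym (sum-assignments-∷ n (λ ks → sumL (λ s → G (ks [ F.zero ]≔ s)) rings)) ⟩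
      sumL (λ ks → sumL (λ s → G (ks [ F.zero ]≔ s)) rings) (assignments (suc n))
    ∎
    where open ≡-Reasoning
  resample (suc n) G (F.suc i) = begin
      length rings * sumL G (assignments (suc n))
    ≡⟨ cong (length rings *_) (sum-assignments-∷ n G) ⟩
      length rings * sumL (λ t → sumL (λ w → G (t ∷ w)) (assignments n)) rings
    ≡⟨ PE.sym (sumL-*ˡ (length rings) _ rings) ⟩
      sumL (λ t → length rings * sumL (λ w → G (t ∷ w)) (assignments n)) rings
    ≡⟨ sumL-cong rings (λ t → resample n (λ w → G (t ∷ w)) i) ⟩
      sumL (λ t → sumL (λ w → sumL (λ s → G (t ∷ (w [ i ]≔ s))) rings) (assignments n)) rings
    ≡⟨ PE.sym (sum-assignments-∷ n (λ ks → sumL (λ s → G (ks [ F.suc i ]≔ s)) rings)) ⟩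
      sumL (λ ks → sumL (λ s → G (ks [ F.suc i ]≔ s)) rings) (assignments (suc n))
    ∎
    where open ≡-Reasoning

  AllOfSizeK : ∀ {n} → Vec (Subset P) n → Set
  AllOfSizeK ks = ∀ i → ∣ lookup ks i ∣ ≡ K

  sum-assignments-cong : ∀ n {G H : Vec (Subset P) n → ℕ} → (∀ ks → AllOfSizeK ks → G ks ≡ H ks) →
    sumL G (assignments n) ≡ sumL H (assignments n)
  sum-assignments-cong zero h = cong (_+ 0) (h [] (λ ()))
  sum-assignments-cong (suc n) {G} {H} h = trans (sum-assignments-∷ n G) (trans
    (sumL-filter-cong (λ s → ∣ s ∣ ≟ K) (allSubsets P)
       (λ t tK → sum-assignments-cong n (λ w aw → h (t ∷ w) (λ { F.zero → tK ; (F.suc i) → aw i }))))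
    (PE.sym (sum-assignments-∷ n H)))

∧-intro : ∀ {a b} → a ≡ true → b ≡ true → a ∧ b ≡ true
∧-intro refl e = e

bool-ext : ∀ {a b} → (a ≡ true → b ≡ true) → (b ≡ true → a ≡ true) → a ≡ b
bool-ext {true} f g = PE.sym (f refl)
bool-ext {false} {true} f g = g refl
bool-ext {false} {false} f g = refl

false≢true : false ≡ true → Empty
false≢true ()

all-tabulate⁻ : ∀ {A : Set} {m} (g : Fin m → A) (f : A → Bool) →
  all f (tabulate g) ≡ true → ∀ i → f (g i) ≡ true
all-tabulate⁻ {m = suc m} g f e F.zero = BP.∧-conicalˡ _ _ e
all-tabulate⁻ {m = suc m} g f e (F.suc i) = all-tabulate⁻ (g ∘ F.suc) f (BP.∧-conicalʳ _ _ e) i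

all-tabulate⁺ : ∀ {A : Set} {m} (g : Fin m → A) (f : A → Bool) →
  (∀ i → f (g i) ≡ true) → all f (tabulate g) ≡ true
all-tabulate⁺ {m = zero} g f h = refl
all-tabulate⁺ {m = suc m} g f h = ∧-intro (h F.zero) (all-tabulate⁺ (g ∘ F.suc) f (λ i → h (F.suc i)))

implies⁻ : ∀ a {b} → (if a then b else true) ≡ true → a ≡ true → b ≡ true
implies⁻ true e refl = e

implies⁺ : ∀ a {b} → (a ≡ true → b ≡ true) → (if a then b else true) ≡ true
implies⁺ true h = h refl
implies⁺ false h = refl

-- every edge of G joins two meeting key rings; for G = graph T this is
-- literally the event  treeInside r≤n T
edgesInside : ∀ {P r n} → r ≤ n → SimpleGraph r → Vec (Subset P) n → Bool
edgesInside {r = r} r≤n G keys =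
  all (λ i → all (λ j →
        if adj G i j
        then meets (lookup keys (inject≤ i r≤n)) (lookup keys (inject≤ j r≤n))
        else true) (allFin r)) (allFin r)

EdgesInside : ∀ {P r n} → r ≤ n → SimpleGraph r → Vec (Subset P) n → Set
EdgesInside r≤n G keys = ∀ i j → adj G i j ≡ true →
  meets (lookup keys (inject≤ i r≤n)) (lookup keys (inject≤ j r≤n)) ≡ true

edgesInside-sound : ∀ {P r n} (r≤n : r ≤ n) G (keys : Vec (Subset P) n) →
  edgesInside r≤n G keys ≡ true → EdgesInside r≤n G keys
edgesInside-sound r≤n G keys e i j a =
  implies⁻ (adj G i j) (all-tabulate⁻ id _ (all-tabulate⁻ id _ e i) j) a

edgesInside-complete : ∀ {P r n} (r≤n : r ≤ n) G (keys : Vec (Subset P) n) →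
  EdgesInside r≤n G keys → edgesInside r≤n G keys ≡ true
edgesInside-complete r≤n G keys h =
  all-tabulate⁺ id _ (λ i → all-tabulate⁺ id _ (λ j → implies⁺ (adj G i j) (h i j)))

good : (P K : ℕ) {r n : ℕ} → r ≤ n → SimpleGraph r → ℕ
good P K {n = n} r≤n G = sumL (ind ∘ edgesInside r≤n G) (KeyRings.assignments P K n)

good-edgeless : ∀ P K {r n} (r≤n : r ≤ n) (G : SimpleGraph r) → (∀ i j → adj G i j ≡ true → Empty) →
  good P K r≤n G ≡ KeyRings.M P K ^ n
good-edgeless P K {n = n} r≤n G noEdge =
  trans (sumL-cong (assignments n) (λ ks → cong ind (edgesInside-complete r≤n G ks (λ i j a → ⊥-elim (noEdge i j a)))))
  (trans (PE.sym (length≡sumL (assignments n))) (length-assignments n))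
  where open KeyRings P K

deleteVertex : ∀ {r} → SimpleGraph r → Fin r → SimpleGraph r
deleteVertex G ℓ = record
  { adj = λ i j → adj G i j ∧ (avoids i ∧ avoids j)
  ; irrefl = λ i → cong (_∧ (avoids i ∧ avoids i)) (irrefl G i)
  ; sym = λ i j → cong₂ _∧_ (sym G i j) (BP.∧-comm (avoids i) (avoids j))
  }
  where
  avoids : Fin _ → Bool
  avoids i = not (does (i F.≟ ℓ))

deleteVertex-adj⁻ : ∀ {r} (G : SimpleGraph r) ℓ i j → adj (deleteVertex G ℓ) i j ≡ true →
  adj G i j ≡ true × ¬ i ≡ ℓ × ¬ j ≡ ℓ
deleteVertex-adj⁻ G ℓ i j e with i F.≟ ℓ | j F.≟ ℓ
... | yes _ | _ rewrite BP.∧-zeroʳ (adj G i j) = ⊥-elim (false≢true e)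
... | no _ | yes _ rewrite BP.∧-zeroʳ (adj G i j) = ⊥-elim (false≢true e)
... | no i≢ℓ | no j≢ℓ = BP.∧-conicalˡ _ _ e , i≢ℓ , j≢ℓ

deleteVertex-adj⁺ : ∀ {r} (G : SimpleGraph r) ℓ i j → adj G i j ≡ true → ¬ i ≡ ℓ → ¬ j ≡ ℓ →
  adj (deleteVertex G ℓ) i j ≡ true
deleteVertex-adj⁺ G ℓ i j e i≢ℓ j≢ℓ with i F.≟ ℓ | j F.≟ ℓ
... | yes i≡ℓ | _ = ⊥-elim (i≢ℓ i≡ℓ)
... | no _ | yes j≡ℓ = ⊥-elim (j≢ℓ j≡ℓ)
... | no _ | no _ rewrite e = refl

record Leaf {r} (G : SimpleGraph r) : Set where
  field
    ℓ p : Fin r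
    edge : adj G ℓ p ≡ true
    uniq : ∀ j → adj G ℓ j ≡ true → j ≡ p

adj⇒≢ : ∀ {r} (G : SimpleGraph r) {i j} → adj G i j ≡ true → ¬ i ≡ j
adj⇒≢ G {i} a refl = false≢true (trans (PE.sym (irrefl G i)) a)

module Peeling {P r n : ℕ} (r≤n : r ≤ n) (G : SimpleGraph r) (leaf : Leaf G) where
  open Leaf leaf
  G-ℓ = deleteVertex G ℓ
  ℓ' = inject≤ ℓ r≤n
  p' = inject≤ p r≤n

  p≢ℓ : ¬ p ≡ ℓ
  p≢ℓ p≡ℓ = adj⇒≢ G edge (PE.sym p≡ℓ)

  edgesInside-resample : ∀ (keys : Vec (Subset P) n) s →
    edgesInside r≤n G (keys [ ℓ' ]≔ s) ≡ edgesInside r≤n G-ℓ keys ∧ meets s (lookup keys p')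
  edgesInside-resample keys s = bool-ext forward backward
    where
    keys' = keys [ ℓ' ]≔ s
    at-ℓ : lookup keys' ℓ' ≡ s
    at-ℓ = VP.lookup∘update ℓ' keys s
    away-ℓ : ∀ i → ¬ i ≡ ℓ → lookup keys' (inject≤ i r≤n) ≡ lookup keys (inject≤ i r≤n)
    away-ℓ i i≢ℓ = VP.lookup∘update′ (λ e → i≢ℓ (FP.inject≤-injective r≤n r≤n i ℓ e)) keys s
    Meets : Subset P → Subset P → Set
    Meets x y = meets x y ≡ true

    forward : edgesInside r≤n G keys' ≡ true → edgesInside r≤n G-ℓ keys ∧ meets s (lookup keys p') ≡ true
    forward e = ∧-intro
      (edgesInside-complete r≤n G-ℓ keys λ i j a →
        let (a₀ , i≢ℓ , j≢ℓ) = deleteVertex-adj⁻ G ℓ i j a in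
        subst₂ Meets (away-ℓ i i≢ℓ) (away-ℓ j j≢ℓ) (present i j a₀))
      (subst₂ Meets at-ℓ (away-ℓ p p≢ℓ) (present ℓ p edge))
      where present = edgesInside-sound r≤n G keys' e

    backward : edgesInside r≤n G-ℓ keys ∧ meets s (lookup keys p') ≡ true → edgesInside r≤n G keys' ≡ true
    backward e = edgesInside-complete r≤n G keys' edgeCase
      where
      present = edgesInside-sound r≤n G-ℓ keys (BP.∧-conicalˡ _ _ e)
      s-meets-p : Meets s (lookup keys p')
      s-meets-p = BP.∧-conicalʳ _ _ e
      -- the only edge at ℓ is ℓp; all other edges survive in G - ℓ
      edgeCase : EdgesInside r≤n G keys'
      edgeCase i j a with i F.≟ ℓ | j F.≟ ℓ
      ... | yes refl | _ with uniq j a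
      ... | refl = subst₂ Meets (PE.sym at-ℓ) (PE.sym (away-ℓ p p≢ℓ)) s-meets-p
      edgeCase i j a | no i≢ℓ | yes refl with uniq i (trans (sym G j i) a)
      ... | refl = subst₂ Meets (PE.sym (away-ℓ p p≢ℓ)) (PE.sym at-ℓ) (trans (meets-sym (lookup keys p') s) s-meets-p)
      edgeCase i j a | no i≢ℓ | no j≢ℓ =
        subst₂ Meets (PE.sym (away-ℓ i i≢ℓ)) (PE.sym (away-ℓ j j≢ℓ)) (present i j (deleteVertex-adj⁺ G ℓ i j a i≢ℓ j≢ℓ))

  peelLeaf : ∀ K → let open KeyRings P K in M * good P K r≤n G ≡ (M ∸ N) * good P K r≤n G-ℓ
  peelLeaf K = begin
      M * good P K r≤n G
    ≡⟨ cong (_* good P K r≤n G) (PE.sym length-rings) ⟩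
      length rings * good P K r≤n G
    ≡⟨ resample n (ind ∘ edgesInside r≤n G) ℓ' ⟩
      sumL (λ ks → sumL (λ s → ind (edgesInside r≤n G (ks [ ℓ' ]≔ s))) rings) (assignments n)
    ≡⟨ sumL-cong (assignments n) (λ ks → sumL-cong rings (λ s →
         trans (cong ind (edgesInside-resample ks s)) (ind-∧ (present ks) (meets s (lookup ks p'))))) ⟩
      sumL (λ ks → sumL (λ s → ind (present ks) * ind (meets s (lookup ks p'))) rings) (assignments n)
    ≡⟨ sumL-cong (assignments n) (λ ks → sumL-*ˡ (ind (present ks)) _ rings) ⟩
      sumL (λ ks → ind (present ks) * sumL (λ s → ind (meets s (lookup ks p'))) rings) (assignments n)
    ≡⟨ sum-assignments-cong n (λ ks sizes → cong (ind (present ks) *_) (meetingRings (lookup ks p') (sizes p'))) ⟩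
      sumL (λ ks → ind (present ks) * (M ∸ N)) (assignments n)
    ≡⟨ sumL-cong (assignments n) (λ ks → NP.*-comm (ind (present ks)) (M ∸ N)) ⟩
      sumL (λ ks → (M ∸ N) * ind (present ks)) (assignments n)
    ≡⟨ sumL-*ˡ (M ∸ N) _ (assignments n) ⟩
      (M ∸ N) * good P K r≤n G-ℓ
    ∎
    where
    open KeyRings P K
    open ≡-Reasoning
    present : Vec (Subset P) n → Bool
    present = edgesInside r≤n G-ℓ

-- Grow a path backwards from an edge: if its first vertex has a neighbour
-- besides the second one, that neighbour is either on the path (closing a
-- cycle) or extends the path.  Paths consist of distinct vertices, so the
-- growth stops after fewer than r steps, at a leaf.

module ForestLeaves {r : ℕ} (G : SimpleGraph r) (acyclic : Acyclic G) where

  record Path (m : ℕ) : Set where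
    field
      vtx : Fin (suc (suc m)) → Fin r
      distinct : ∀ a b → vtx a ≡ vtx b → a ≡ b
      consec : ∀ (a : Fin (suc m)) → adj G (vtx (inject₁ a)) (vtx (F.suc a)) ≡ true

  path-length : ∀ {m} → Path m → suc (suc m) ≤ r
  path-length π = FP.injective⇒≤ (λ {a} {b} → Path.distinct π a b)

  pathCycle : ∀ {m} (π : Path m) (j : Fin m) → adj G (Path.vtx π (F.suc (F.suc j))) (Path.vtx π F.zero) ≡ true →
    Cycle G
  pathCycle {m} π j closes = record
    { len = toℕ j
    ; vtx = λ a → vtx (inject≤ a prefix)
    ; distinct = λ a b e → FP.inject≤-injective prefix prefix a b (distinct _ _ e)
    ; consec = consec'
    ; closing = subst₂ (λ x y → adj G (vtx x) (vtx y) ≡ true) (PE.sym last) refl closes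
    }
    where
    open Path π
    prefix : suc (suc (suc (toℕ j))) ≤ suc (suc m)
    prefix = s≤s (s≤s (FP.toℕ<n j))
    prefix' : suc (suc (toℕ j)) ≤ suc m
    prefix' = s≤s (FP.toℕ<n j)
    last : inject≤ (fromℕ (suc (suc (toℕ j)))) prefix ≡ F.suc (F.suc j)
    last = FP.toℕ-injective (trans (FP.toℕ-inject≤ (fromℕ (suc (suc (toℕ j)))) prefix) (FP.toℕ-fromℕ _))
    consec' : ∀ (a : Fin (suc (suc (toℕ j)))) →
      adj G (vtx (inject≤ (inject₁ a) prefix)) (vtx (inject≤ (F.suc a) prefix)) ≡ true
    consec' a = subst₂ (λ x y → adj G (vtx x) (vtx y) ≡ true) (PE.sym here≡) (PE.sym next≡) (consec b)
      where
      b = inject≤ a prefix'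
      here≡ : inject≤ (inject₁ a) prefix ≡ inject₁ b
      here≡ = FP.toℕ-injective (trans (FP.toℕ-inject≤ (inject₁ a) prefix) (trans (FP.toℕ-inject₁ a)
                (PE.sym (trans (FP.toℕ-inject₁ b) (FP.toℕ-inject≤ a prefix')))))
      next≡ : inject≤ (F.suc a) prefix ≡ F.suc b
      next≡ = FP.toℕ-injective (trans (FP.toℕ-inject≤ (F.suc a) prefix) (cong suc (PE.sym (FP.toℕ-inject≤ a prefix'))))

  prepend : ∀ {m} (π : Path m) w → adj G w (Path.vtx π F.zero) ≡ true → (∀ i → ¬ Path.vtx π i ≡ w) → Path (suc m)
  prepend {m} π w a fresh = record { vtx = vtx' ; distinct = distinct' ; consec = consec' }
    where
    open Path π
    vtx' : Fin (suc (suc (suc m))) → Fin r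
    vtx' F.zero = w
    vtx' (F.suc i) = vtx i
    distinct' : ∀ a b → vtx' a ≡ vtx' b → a ≡ b
    distinct' F.zero F.zero e = refl
    distinct' F.zero (F.suc b) e = ⊥-elim (fresh b (PE.sym e))
    distinct' (F.suc a) F.zero e = ⊥-elim (fresh a e)
    distinct' (F.suc a) (F.suc b) e = cong F.suc (distinct a b e)
    consec' : ∀ (b : Fin (suc (suc m))) → adj G (vtx' (inject₁ b)) (vtx' (F.suc b)) ≡ true
    consec' F.zero = a
    consec' (F.suc b) = consec b

  leafOrExtend : ∀ {m} → Path m → Leaf G ⊎ Path (suc m)
  leafOrExtend π with FP.any? (λ w → (adj G (Path.vtx π F.zero) w B.≟ true) ×-dec ¬? (w F.≟ Path.vtx π (F.suc F.zero)))
  ... | no noOther = inj₁ record { ℓ = vtx F.zero ; p = vtx (F.suc F.zero) ; edge = consec F.zero ; uniq = uniq }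
    where
    open Path π
    uniq : ∀ j → adj G (vtx F.zero) j ≡ true → j ≡ vtx (F.suc F.zero)
    uniq j a with j F.≟ vtx (F.suc F.zero)
    ... | yes j≡v₁ = j≡v₁
    ... | no j≢v₁ = ⊥-elim (noOther (j , a , j≢v₁))
  ... | yes (w , a , w≢v₁) with FP.any? (λ i → Path.vtx π i F.≟ w)
  ...   | yes (F.zero , v₀≡w) = ⊥-elim (adj⇒≢ G a v₀≡w)
  ...   | yes (F.suc F.zero , v₁≡w) = ⊥-elim (w≢v₁ (PE.sym v₁≡w))
  ...   | yes (F.suc (F.suc j) , vⱼ≡w) = ⊥-elim (acyclic (pathCycle π j
            (subst (λ z → adj G z (Path.vtx π F.zero) ≡ true) (PE.sym vⱼ≡w) (trans (sym G w (Path.vtx π F.zero)) a))))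
  ...   | no fresh = inj₂ (prepend π w (trans (sym G w (Path.vtx π F.zero)) a) (λ i e → fresh (i , e)))

  -- extend at most d times: a path of m + 2 ≥ r - d vertices reaches a leaf
  findLeaf : ∀ d {m} → r ≤ d + suc (suc m) → Path m → Leaf G
  findLeaf d bound π with leafOrExtend π
  ... | inj₁ leaf = leaf
  findLeaf zero bound π | inj₂ π' = ⊥-elim (NP.<-irrefl refl (NP.≤-trans (path-length π') bound))
  findLeaf (suc d) {m} bound π | inj₂ π' = findLeaf d (subst (r ≤_) (PE.sym (NP.+-suc d (suc (suc m)))) bound) π'

  leafFromEdge : ∀ u w → adj G u w ≡ true → Leaf G
  leafFromEdge u w a = findLeaf r (NP.m≤m+n r 2) edgePath
    where
    vtx : Fin 2 → Fin r
    vtx F.zero = u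
    vtx (F.suc F.zero) = w
    distinct : ∀ x y → vtx x ≡ vtx y → x ≡ y
    distinct F.zero F.zero e = refl
    distinct F.zero (F.suc F.zero) e = ⊥-elim (adj⇒≢ G a e)
    distinct (F.suc F.zero) F.zero e = ⊥-elim (adj⇒≢ G a (PE.sym e))
    distinct (F.suc F.zero) (F.suc F.zero) e = refl
    edgePath : Path 0
    edgePath = record { vtx = vtx ; distinct = distinct ; consec = λ { F.zero → a } }

member : ∀ {r} (A : Subset r) k → ∣ A ∣ ≡ suc k → ∃ λ u → lookup A u ≡ true
member (true ∷ A) k e = F.zero , refl
member (false ∷ A) k e with member A k e
... | u , u∈A = F.suc u , u∈A

∣remove∣ : ∀ {r} (A : Subset r) u → lookup A u ≡ true → suc ∣ A [ u ]≔ false ∣ ≡ ∣ A ∣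
∣remove∣ (true ∷ A) F.zero refl = refl
∣remove∣ (true ∷ A) (F.suc u) u∈A = cong suc (∣remove∣ A u u∈A)
∣remove∣ (false ∷ A) (F.suc u) u∈A = ∣remove∣ A u u∈A

removed-∉ : ∀ {r} (A : Subset r) u → ¬ lookup (A [ u ]≔ false) u ≡ true
removed-∉ A u u∈ = false≢true (trans (PE.sym (VP.lookup∘update u A false)) u∈)

removed-∈ : ∀ {r} (A : Subset r) {u v} → ¬ v ≡ u → lookup A v ≡ true → lookup (A [ u ]≔ false) v ≡ true
removed-∈ A v≢u v∈A = trans (VP.lookup∘update′ v≢u A false) v∈A

two-members : ∀ {r} (A : Subset r) k → ∣ A ∣ ≡ suc (suc k) →
  Σ (Fin r) λ u → Σ (Fin r) λ v → ¬ u ≡ v × lookup A u ≡ true × lookup A v ≡ true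
two-members A k e with member A (suc k) e
... | u , u∈A with member (A [ u ]≔ false) k (NP.suc-injective (trans (∣remove∣ A u u∈A) e))
... | v , v∈A-u = u , v , u≢v , u∈A , trans (PE.sym (VP.lookup∘update′ (λ v≡u → u≢v (PE.sym v≡u)) A false)) v∈A-u
  where
  u≢v : ¬ u ≡ v
  u≢v refl = removed-∉ A u v∈A-u

singleton-unique : ∀ {r} (A : Subset r) → ∣ A ∣ ≡ 1 → ∀ u v → lookup A u ≡ true → lookup A v ≡ true → u ≡ v
singleton-unique A e u v u∈A v∈A with v F.≟ u
... | yes v≡u = PE.sym v≡u
... | no v≢u with trans (∣remove∣ (A [ u ]≔ false) v (removed-∈ A v≢u v∈A)) (NP.suc-injective (trans (∣remove∣ A u u∈A) e))
... | ()

record TreeOn {r} (G : SimpleGraph r) (A : Subset r) : Set where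
  field
    edgesIn : ∀ i j → adj G i j ≡ true → lookup A i ≡ true
    walks : ∀ u v → lookup A u ≡ true → lookup A v ≡ true → Walk G u v
    noCycle : Acyclic G

walk-first-edge : ∀ {r} {G : SimpleGraph r} {u v} → Walk G u v → ¬ u ≡ v → Σ (Fin r) λ w → adj G u w ≡ true
walk-first-edge here u≢v = ⊥-elim (u≢v refl)
walk-first-edge (step {w = w} a _) _ = w , a

module DeleteLeaf {r} (G : SimpleGraph r) (leaf : Leaf G) where
  open Leaf leaf
  G-ℓ = deleteVertex G ℓ

  -- a walk between vertices other than the leaf can be rerouted around it:
  -- any visit to ℓ enters and leaves through p, so it can be cut out
  walk-avoiding : ∀ {u v} → Walk G u v → ¬ u ≡ ℓ → ¬ v ≡ ℓ → Walk G-ℓ u v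
  walk-avoiding here u≢ℓ v≢ℓ = here
  walk-avoiding (step {w = w} a rest) u≢ℓ v≢ℓ with w F.≟ ℓ
  walk-avoiding (step {u = u} {w = w} a rest) u≢ℓ v≢ℓ | no w≢ℓ =
    step (deleteVertex-adj⁺ G ℓ u w a u≢ℓ w≢ℓ) (walk-avoiding rest w≢ℓ v≢ℓ)
  walk-avoiding (step a here) u≢ℓ v≢ℓ | yes w≡ℓ = ⊥-elim (v≢ℓ w≡ℓ)
  walk-avoiding (step {u = u} a (step {w = w'} a' rest)) u≢ℓ v≢ℓ | yes refl =
    subst (λ z → Walk G-ℓ z _) (trans w'≡p (PE.sym u≡p))
      (walk-avoiding rest (λ w'≡ℓ → adj⇒≢ G edge (trans (PE.sym w'≡ℓ) w'≡p)) v≢ℓ)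
    where
    u≡p : u ≡ p
    u≡p = uniq u (trans (sym G ℓ u) a)
    w'≡p : w' ≡ p
    w'≡p = uniq w' a'

  acyclic-delete : Acyclic G → Acyclic G-ℓ
  acyclic-delete noCycle c = noCycle record
    { len = Cycle.len c ; vtx = Cycle.vtx c ; distinct = Cycle.distinct c
    ; consec = λ a → proj₁ (deleteVertex-adj⁻ G ℓ _ _ (Cycle.consec c a))
    ; closing = proj₁ (deleteVertex-adj⁻ G ℓ _ _ (Cycle.closing c)) }

  treeOn-delete : ∀ A → TreeOn G A → TreeOn G-ℓ (A [ ℓ ]≔ false)
  treeOn-delete A tree = record
    { edgesIn = λ i j a → let (a₀ , i≢ℓ , _) = deleteVertex-adj⁻ G ℓ i j a in
        removed-∈ A i≢ℓ (TreeOn.edgesIn tree i j a₀)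
    ; walks = λ u v u∈ v∈ → walk-avoiding (TreeOn.walks tree u v (inA u u∈) (inA v v∈)) (≢ℓ u u∈) (≢ℓ v v∈)
    ; noCycle = acyclic-delete (TreeOn.noCycle tree) }
    where
    ≢ℓ : ∀ u → lookup (A [ ℓ ]≔ false) u ≡ true → ¬ u ≡ ℓ
    ≢ℓ u u∈ refl = removed-∉ A ℓ u∈
    inA : ∀ u → lookup (A [ ℓ ]≔ false) u ≡ true → lookup A u ≡ true
    inA u u∈ = trans (PE.sym (VP.lookup∘update′ (≢ℓ u u∈) A false)) u∈

treeCount : ∀ P K {r n} (r≤n : r ≤ n) k (G : SimpleGraph r) (A : Subset r) → TreeOn G A → ∣ A ∣ ≡ suc k →
  let open KeyRings P K in M ^ k * good P K r≤n G ≡ (M ∸ N) ^ k * M ^ n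
treeCount P K r≤n zero G A tree size = cong (1 *_) (good-edgeless P K r≤n G noEdge)
  where
  noEdge : ∀ i j → adj G i j ≡ true → Empty
  noEdge i j a = adj⇒≢ G a (singleton-unique A size i j
    (TreeOn.edgesIn tree i j a) (TreeOn.edgesIn tree j i (trans (sym G j i) a)))
treeCount P K {n = n} r≤n (suc k) G A tree size with two-members A k size
... | u , v , u≢v , u∈A , v∈A with walk-first-edge (TreeOn.walks tree u v u∈A v∈A) u≢v
... | w , a = begin
    M ^ suc k * good P K r≤n G            ≡⟨ trans (NP.*-assoc M (M ^ k) _) (swap M (M ^ k) _) ⟩
    M ^ k * (M * good P K r≤n G)          ≡⟨ cong (M ^ k *_) (Peeling.peelLeaf r≤n G leaf K) ⟩
    M ^ k * ((M ∸ N) * good P K r≤n G-ℓ)  ≡⟨ swap (M ^ k) (M ∸ N) (good P K r≤n G-ℓ) ⟩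
    (M ∸ N) * (M ^ k * good P K r≤n G-ℓ)  ≡⟨ cong ((M ∸ N) *_) smaller ⟩
    (M ∸ N) * ((M ∸ N) ^ k * M ^ n)       ≡⟨ PE.sym (NP.*-assoc (M ∸ N) ((M ∸ N) ^ k) (M ^ n)) ⟩
    (M ∸ N) ^ suc k * M ^ n               ∎
  where
  open KeyRings P K
  open ≡-Reasoning
  leaf = ForestLeaves.leafFromEdge G (TreeOn.noCycle tree) u w a
  ℓ = Leaf.ℓ leaf
  G-ℓ = deleteVertex G ℓ
  size-ℓ : ∣ A [ ℓ ]≔ false ∣ ≡ suc k
  size-ℓ = NP.suc-injective (trans (∣remove∣ A ℓ (TreeOn.edgesIn tree _ _ (Leaf.edge leaf))) size)
  smaller = treeCount P K r≤n k G-ℓ (A [ ℓ ]≔ false) (DeleteLeaf.treeOn-delete G leaf A tree) size-ℓ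
  swap : ∀ x y z → x * (y * z) ≡ y * (x * z)
  swap = solve-∀

lemma6 : (K P n : ℕ) → 1 ≤ K → 1 ≤ P → 2 * K ≤ P → 2 ≤ n →
    (r : ℕ) → 2 ≤ r → (r≤n : r ≤ n) → (T : SpanningTree r) →
    prob (keyAssignments n P K) (treeInside r≤n T) ≡ (1ℚ - q K P) ^ℚ (r ∸ 1)
lemma6 K P n _ _ 2K≤P _ (suc (suc k)) (s≤s (s≤s z≤n)) r≤n T = begin
    prob (keyAssignments n P K) (treeInside r≤n T)
  ≡⟨ cong₂ ratio (count≡sumL (treeInside r≤n T) (assignments n)) (length-assignments n) ⟩
    ratio (good P K r≤n (graph T)) (M ^ n)
  ≡⟨ ratio-from-count M N _ n (suc k) (C-pos P K K≤P) N≤M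
       (treeCount P K r≤n (suc k) (graph T) ⊤ spanning (∣⊤∣≡n (suc (suc k)))) ⟩
    (1ℚ - q K P) ^ℚ suc k
  ∎
  where
  open KeyRings P K
  open ≡-Reasoning
  K≤P : K ≤ P
  K≤P = NP.≤-trans (NP.m≤m+n K (K + 0)) 2K≤P
  N≤M : N ≤ M
  N≤M = subst (λ z → N ≤ z C K) (NP.m+[n∸m]≡n K≤P) (C-mono K (P ∸ K) K)
  spanning : TreeOn (graph T) ⊤
  spanning = record
    { edgesIn = λ i _ _ → VP.lookup-replicate i true
    ; walks = λ u v _ _ → connected T u v
    ; noCycle = acyclic T }
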